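{- Let $D$ be a connected, vertex transitive digraph with directed diameter $d$. Then $D$ is a $\frac{1}{3d}$-expander.
   Context: All digraphs are finite, without loops or multiple arcs. A digraph is vertex transitive if its automorphism group acts transitively on its vertices; it is connected if its underlying undirected graph is connected. The directed distance $d(u,v)$ is the length of a shortest directed path from $u$ to $v$ (infinite if none exists); the directed diameter is $\max_{u,v}d(u,v)$. For $U\subseteq V(D)$, $N^+(U)$ is the set of vertices not in $U$ that are heads of arcs with tails in $U$, and $N^-(U)$ is the set of vertices not in $U$ that are tails of arcs with heads in $U$. For $\alpha>0$, $D$ is an $\alpha$-expander if $|V(D)|\ge 2$ and for every $U\subseteq V(D)$ with $|U|\le\frac23|V(D)|$ we have $|N^+(U)|\ge\alpha|U|$ and $|N^-(U)|\ge\alpha|U|$. -}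

module Defs where

open import Data.Nat using (ℕ; zero; suc; _+_; _*_; _≤_)
open import Data.Bool using (Bool; true; false; _∧_; _∨_; not)
open import Data.Fin using (Fin; zero; suc)
open import Data.Fin.Subset using (Subset; ∣_∣)
open import Data.Vec using (lookup; tabulate)
open import Data.Product using (Σ; ∃; ∃-syntax; _×_; _,_)
open import Data.Sum using (_⊎_)
open import Function.Bundles using (_↔_; Inverse)
open import Relation.Binary.PropositionalEquality using (_≡_)

record Digraph : Set where
  field
    n      : ℕ
    arc    : Fin n → Fin n → Bool
    noLoop : ∀ v → arc v v ≡ false

open Digraph public

anyFin : ∀ {m} → (Fin m → Bool) → Bool
anyFin {zero}  f = false
anyFin {suc m} f = f zero ∨ anyFin (λ i → f (suc i))

module _ (D : Digraph) where
  private
    V = Fin (n D)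
    A = arc D

  IsAutomorphism : (V ↔ V) → Set
  IsAutomorphism σ = ∀ u v → A (Inverse.to σ u) (Inverse.to σ v) ≡ A u v

  VertexTransitive : Set
  VertexTransitive =
    ∀ u v → Σ (V ↔ V) λ σ → IsAutomorphism σ × (Inverse.to σ u ≡ v)

  data UWalk : V → V → Set where
    unil  : ∀ {u} → UWalk u u
    ucons : ∀ {u w v} → (A u w ≡ true ⊎ A w u ≡ true) → UWalk w v → UWalk u v

  Connected : Set
  Connected = ∀ u v → UWalk u v

  data Walk : V → V → ℕ → Set where
    nil  : ∀ {u} → Walk u u 0
    cons : ∀ {u w v k} → A u w ≡ true → Walk w v k → Walk u v (suc k)

  -- D has directed diameter d: every directed distance is at most d
  -- (in particular finite), and some directed distance equals d.
  -- (A shortest directed walk is a directed path, so walks suffice.)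
  HasDirectedDiameter : ℕ → Set
  HasDirectedDiameter d =
    (∀ u v → ∃[ k ] (k ≤ d × Walk u v k)) ×
    (∃[ u ] ∃[ v ] (∀ k → Walk u v k → d ≤ k))

  N⁺ : Subset (n D) → Subset (n D)
  N⁺ U = tabulate λ w → not (lookup U w) ∧ anyFin (λ v → lookup U v ∧ A v w)

  N⁻ : Subset (n D) → Subset (n D)
  N⁻ U = tabulate λ w → not (lookup U w) ∧ anyFin (λ v → lookup U v ∧ A w v)

  -- D is an α-expander for α = p / q (p, q natural numbers, α > 0 is imposed
  -- by the caller): |V| ≥ 2 and for every U with |U| ≤ (2/3)|V|,
  -- |N⁺(U)| ≥ α|U| and |N⁻(U)| ≥ α|U|, all inequalities cleared of denominators.
  IsExpander : (p q : ℕ) → Set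
  IsExpander p q =
    2 ≤ n D ×
    (∀ (U : Subset (n D)) → 3 * ∣ U ∣ ≤ 2 * n D →
       (p * ∣ U ∣ ≤ q * ∣ N⁺ U ∣) × (p * ∣ U ∣ ≤ q * ∣ N⁻ U ∣))

{-# OPTIONS --safe #-}
module Submission where

-- Average over the automorphism group Γ. Fix v₀ and, for every
-- vertex y, a walk P_y of length at most d from v₀ to y, and count the pairs
-- (σ, y) ∈ Γ × V with σ v₀ ∈ U and σ y ∉ U. Every vertex z is the image of a
-- given vertex x under the same number c = #[ x ↦ z ] of automorphisms, so
-- there are exactly c |U| |V ∖ U| such pairs. For each of them the walk σ P_y
-- leaves U, so the head of one of its arcs lies in N⁺(U); the pairs are
-- therefore at most n · d · c |N⁺(U)|. Hence |U| |V ∖ U| ≤ n d |N⁺(U)|, and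
-- |V ∖ U| ≥ n / 3 gives |U| ≤ 3 d |N⁺(U)|. N⁻(U) is N⁺(U) in the reversed
-- digraph.

open import Defs
open import Data.Nat using (ℕ; zero; suc; _+_; _*_; _∸_; _^_; _≤_; z≤n; NonZero; >-nonZero)
open import Data.Nat.Properties hiding (_≟_)
open import Data.Bool using (Bool; true; false; not; _∧_; _∨_)
import Data.Bool.Properties as Bool
open import Data.Fin using (Fin; zero; suc; finToFun; funToFin; combine; fromℕ<)
open import Data.Fin.Properties using (_≟_; nonZeroIndex; all?; any?; finToFun-funToFin; funToFin-finToFin)
open import Data.Fin.Permutation using (permutation)
open import Data.Fin.Subset using (Subset; ∣_∣; ∁)
open import Data.Fin.Subset.Properties using (∣∁p∣≡n∸∣p∣)
open import Data.Vec using ([]; _∷_; lookup)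
open import Data.Vec.Properties using (lookup-map; lookup∘tabulate)
open import Data.Product using (∃-syntax; _×_; _,_; proj₁; proj₂)
open import Function using (_∘_; _↔_; _⇔_; mk⇔; mk↔ₛ′; Inverse)
open import Function.Construct.Symmetry using (↔-sym)
open import Relation.Nullary using (Dec; does; yes; no; contradiction)
open import Relation.Nullary.Decidable using (_×-dec_; _→-dec_; dec-true; does-⇔)
open import Relation.Binary.PropositionalEquality
open import Algebra.Properties.Semiring.Sum +-*-semiring
open import Algebra.Properties.CommutativeSemigroup *-commutativeSemigroup using (x∙yz≈y∙xz)

open Inverse using (to; from; strictlyInverseˡ; strictlyInverseʳ)

𝟙 : Bool → ℕ
𝟙 true  = 1
𝟙 false = 0

𝟙-does-*-monoʳ-≤ : ∀ {P : Set} (P? : Dec P) {a b} → (P → a ≤ b) → 𝟙 (does P?) * a ≤ 𝟙 (does P?) * b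
𝟙-does-*-monoʳ-≤ (yes p) a≤b = *-monoʳ-≤ 1 (a≤b p)
𝟙-does-*-monoʳ-≤ (no _)  _   = z≤n

∣p∣≡sum𝟙 : ∀ {m} (p : Subset m) → ∣ p ∣ ≡ sum (λ i → 𝟙 (lookup p i))
∣p∣≡sum𝟙 []          = refl
∣p∣≡sum𝟙 (true ∷ p)  = cong suc (∣p∣≡sum𝟙 p)
∣p∣≡sum𝟙 (false ∷ p) = ∣p∣≡sum𝟙 p

anyFin-intro : ∀ {m} (f : Fin m → Bool) i → f i ≡ true → anyFin f ≡ true
anyFin-intro f zero    fi≡true = cong (_∨ anyFin (f ∘ suc)) fi≡true
anyFin-intro f (suc i) fi≡true = trans (cong (f zero ∨_) (anyFin-intro (f ∘ suc) i fi≡true)) (Bool.∨-zeroʳ (f zero))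

sum-mono-≤ : ∀ {m} {f g : Fin m → ℕ} → (∀ i → f i ≤ g i) → sum f ≤ sum g
sum-mono-≤ {zero}  _   = z≤n
sum-mono-≤ {suc m} f≤g = +-mono-≤ (f≤g zero) (sum-mono-≤ (f≤g ∘ suc))

f≤sum : ∀ {m} (f : Fin m → ℕ) i → f i ≤ sum f
f≤sum f zero    = m≤m+n _ _
f≤sum f (suc i) = ≤-trans (f≤sum (f ∘ suc) i) (m≤n+m _ _)

sum-const : ∀ m k → sum {m} (λ _ → k) ≡ m * k
sum-const zero    k = refl
sum-const (suc m) k = cong (k +_) (sum-const m k)

sum-δ : ∀ {m} (h : Fin m → ℕ) w → h w ≡ sum (λ z → 𝟙 (does (w ≟ z)) * h z)
sum-δ {suc m} h zero = begin
  h zero                                    ≡⟨ +-identityʳ (h zero) ⟨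
  h zero + 0                                ≡⟨ cong₂ _+_ (+-identityʳ (h zero)) (sum-replicate-zero m) ⟨
  1 * h zero + sum (λ z → 0 * h (suc z))   ∎
  where open ≡-Reasoning
sum-δ {suc m} h (suc w) = sum-δ (h ∘ suc) w

u*[m∸u]≤m*k⇒u≤3*k : ∀ {u m k} .{{_ : NonZero m}} → 3 * u ≤ 2 * m → u * (m ∸ u) ≤ m * k → u ≤ 3 * k
u*[m∸u]≤m*k⇒u≤3*k {u} {m} {k} 3u≤2m uw≤mk = *-cancelˡ-≤ m (begin
  m * u               ≤⟨ *-monoˡ-≤ u m≤3[m∸u] ⟩
  3 * (m ∸ u) * u     ≡⟨ *-assoc 3 (m ∸ u) u ⟩
  3 * ((m ∸ u) * u)   ≡⟨ cong (3 *_) (*-comm (m ∸ u) u) ⟩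
  3 * (u * (m ∸ u))   ≤⟨ *-monoʳ-≤ 3 uw≤mk ⟩
  3 * (m * k)         ≡⟨ x∙yz≈y∙xz 3 m k ⟩
  m * (3 * k)         ∎)
  where
    open ≤-Reasoning
    m≤3[m∸u] : m ≤ 3 * (m ∸ u)
    m≤3[m∸u] = begin
      m                 ≡⟨ m+n∸n≡m m (2 * m) ⟨
      3 * m ∸ 2 * m     ≤⟨ ∸-monoʳ-≤ (3 * m) 3u≤2m ⟩
      3 * m ∸ 3 * u     ≡⟨ *-distribˡ-∸ 3 m u ⟨
      3 * (m ∸ u)       ∎

funToFin-cong : ∀ {m k} {f g : Fin m → Fin k} → f ≗ g → funToFin f ≡ funToFin g
funToFin-cong {zero}  _   = refl
funToFin-cong {suc m} f≗g = cong₂ combine (f≗g zero) (funToFin-cong (f≗g ∘ suc))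

-- Self-maps of Fin m are enumerated by their codes in Fin (m ^ m); as
-- finToFun (funToFin f) is only pointwise equal to f, summands must respect ≗.
Extensional : ∀ {m} → ((Fin m → Fin m) → ℕ) → Set
Extensional h = ∀ {f g} → f ≗ g → h f ≡ h g

sumMaps : ∀ {m} → ((Fin m → Fin m) → ℕ) → ℕ
sumMaps {m} h = sum {m ^ m} (h ∘ finToFun)

private
  recode : ∀ {m} (α β : Fin m ↔ Fin m) → Fin (m ^ m) → Fin (m ^ m)
  recode α β a = funToFin (to α ∘ finToFun a ∘ to β)

  recode-inverse : ∀ {m} (α β : Fin m ↔ Fin m) a → recode (↔-sym α) (↔-sym β) (recode α β a) ≡ a
  recode-inverse {m} α β a = trans (funToFin-cong pointwise) (funToFin-finToFin {m} {m} a)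
    where
      pointwise : from α ∘ finToFun (recode α β a) ∘ from β ≗ finToFun a
      pointwise i = begin
        from α (finToFun (recode α β a) (from β i))     ≡⟨ cong (from α) (finToFun-funToFin _ (from β i)) ⟩
        from α (to α (finToFun a (to β (from β i))))    ≡⟨ strictlyInverseʳ α _ ⟩
        finToFun a (to β (from β i))                    ≡⟨ cong (finToFun a) (strictlyInverseˡ β i) ⟩
        finToFun a i                                    ∎
        where open ≡-Reasoning

sumMaps-compose : ∀ {m} (α β : Fin m ↔ Fin m) {h : (Fin m → Fin m) → ℕ} → Extensional h →
                  sumMaps (λ f → h (to α ∘ f ∘ to β)) ≡ sumMaps h
sumMaps-compose {m} α β {h} h-ext = sym (begin
  sumMaps h                                          ≡⟨ sum-permute (h ∘ finToFun) π ⟩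
  sum {m ^ m} (λ a → h (finToFun (recode α β a)))    ≡⟨ sum-cong-≗ (λ a → h-ext (finToFun-funToFin (to α ∘ finToFun a ∘ to β))) ⟩
  sumMaps (λ f → h (to α ∘ f ∘ to β))                ∎)
  where
    open ≡-Reasoning
    π = permutation (recode α β) (recode (↔-sym α) (↔-sym β))
                    (recode-inverse (↔-sym α) (↔-sym β)) (recode-inverse α β)

module _ (D : Digraph) where
  private
    V = Fin (n D)
    A = arc D

  ArcPreserving : (V → V) → Set
  ArcPreserving σ = ∀ x y → A (σ x) (σ y) ≡ A x y

  -- A decidable counterpart of IsAutomorphism for plain maps, so that the
  -- automorphisms can be counted among all self-maps of the vertex set.
  IsAutomorphismMap : (V → V) → Set
  IsAutomorphismMap σ = (∀ x y → σ x ≡ σ y → x ≡ y) × (∀ z → ∃[ x ] σ x ≡ z) × ArcPreserving σ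

  isAutomorphismMap? : ∀ σ → Dec (IsAutomorphismMap σ)
  isAutomorphismMap? σ =
    all? (λ x → all? (λ y → (σ x ≟ σ y) →-dec (x ≟ y))) ×-dec
    all? (λ z → any? (λ x → σ x ≟ z)) ×-dec
    all? (λ x → all? (λ y → A (σ x) (σ y) Bool.≟ A x y))

  IsAutomorphismMap-resp : ∀ {σ τ} → σ ≗ τ → IsAutomorphismMap σ → IsAutomorphismMap τ
  IsAutomorphismMap-resp {σ} {τ} σ≗τ (inj , surj , pres) =
    (λ x y τx≡τy → inj x y (trans (σ≗τ x) (trans τx≡τy (sym (σ≗τ y))))) ,
    (λ z → let x , σx≡z = surj z in x , trans (sym (σ≗τ x)) σx≡z) ,
    (λ x y → trans (sym (cong₂ A (σ≗τ x) (σ≗τ y))) (pres x y))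

  IsAutomorphismMap-∘ : ∀ {σ τ} → IsAutomorphismMap σ → IsAutomorphismMap τ → IsAutomorphismMap (σ ∘ τ)
  IsAutomorphismMap-∘ {σ} {τ} (σ-inj , σ-surj , σ-pres) (τ-inj , τ-surj , τ-pres) =
    (λ x y eq → τ-inj x y (σ-inj (τ x) (τ y) eq)) ,
    (λ z → let y , σy≡z = σ-surj z ; x , τx≡y = τ-surj y in x , trans (cong σ τx≡y) σy≡z) ,
    (λ x y → trans (σ-pres (τ x) (τ y)) (τ-pres x y))

  automorphism⇒map : ∀ α → IsAutomorphism D α → IsAutomorphismMap (to α)
  automorphism⇒map α α-pres =
    (λ x y eq → trans (sym (strictlyInverseʳ α x)) (trans (cong (from α) eq) (strictlyInverseʳ α y))) ,
    (λ z → from α z , strictlyInverseˡ α z) ,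
    α-pres

  automorphism-sym : ∀ α → IsAutomorphism D α → IsAutomorphism D (↔-sym α)
  automorphism-sym α α-pres x y =
    trans (sym (α-pres (from α x) (from α y))) (cong₂ A (strictlyInverseˡ α x) (strictlyInverseˡ α y))

  map⇒↔ : ∀ {σ} → IsAutomorphismMap σ → V ↔ V
  map⇒↔ {σ} (inj , surj , _) =
    mk↔ₛ′ σ (proj₁ ∘ surj) (proj₂ ∘ surj) (λ x → inj _ x (proj₂ (surj (σ x))))

  IsAutomorphismMap-compose⇔ : ∀ α β {σ} → IsAutomorphism D α → IsAutomorphism D β →
                               IsAutomorphismMap (to α ∘ σ ∘ to β) ⇔ IsAutomorphismMap σ
  IsAutomorphismMap-compose⇔ α β {σ} α-aut β-aut = mk⇔
    (λ ασβ-aut → IsAutomorphismMap-resp cancel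
      (IsAutomorphismMap-∘ {σ = from α ∘ (to α ∘ σ ∘ to β)}
        (IsAutomorphismMap-∘ {σ = from α} (automorphism⇒map (↔-sym α) (automorphism-sym α α-aut)) ασβ-aut)
        (automorphism⇒map (↔-sym β) (automorphism-sym β β-aut))))
    (λ σ-aut → IsAutomorphismMap-∘ {σ = to α ∘ σ}
      (IsAutomorphismMap-∘ {σ = to α} (automorphism⇒map α α-aut) σ-aut) (automorphism⇒map β β-aut))
    where
      cancel : from α ∘ (to α ∘ σ ∘ to β) ∘ from β ≗ σ
      cancel x = trans (strictlyInverseʳ α _) (cong σ (strictlyInverseˡ β x))

  𝟙Aut : (V → V) → ℕ
  𝟙Aut σ = 𝟙 (does (isAutomorphismMap? σ))

  𝟙Aut-resp : ∀ {σ τ} → σ ≗ τ → 𝟙Aut σ ≡ 𝟙Aut τ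
  𝟙Aut-resp {σ} {τ} σ≗τ = cong 𝟙 (does-⇔ (mk⇔ (IsAutomorphismMap-resp σ≗τ) (IsAutomorphismMap-resp (sym ∘ σ≗τ)))
                                  (isAutomorphismMap? σ) (isAutomorphismMap? τ))

  sumAut : ((V → V) → ℕ) → ℕ
  sumAut h = sumMaps (λ σ → 𝟙Aut σ * h σ)

  sumAut-mono-≤ : ∀ {h g} → (∀ σ → IsAutomorphismMap σ → h σ ≤ g σ) → sumAut h ≤ sumAut g
  sumAut-mono-≤ h≤g = sum-mono-≤ (λ a → 𝟙-does-*-monoʳ-≤ (isAutomorphismMap? (finToFun a)) (h≤g (finToFun a)))

  sumAut-cong : ∀ {h g} → (∀ σ → IsAutomorphismMap σ → h σ ≡ g σ) → sumAut h ≡ sumAut g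
  sumAut-cong h≡g = ≤-antisym (sumAut-mono-≤ (λ σ σ-aut → ≤-reflexive (h≡g σ σ-aut)))
                              (sumAut-mono-≤ (λ σ σ-aut → ≤-reflexive (sym (h≡g σ σ-aut))))

  sumAut-comm : ∀ {m} (f : (V → V) → Fin m → ℕ) → sumAut (λ σ → sum (f σ)) ≡ sum (λ y → sumAut (λ σ → f σ y))
  sumAut-comm f = trans (sum-cong-≗ (λ a → *-distribˡ-sum (𝟙Aut (finToFun a)) (f (finToFun a))))
                        (∑-comm (λ a y → 𝟙Aut (finToFun a) * f (finToFun a) y))

  sumAut-*ʳ : ∀ h k → sumAut (λ σ → h σ * k) ≡ sumAut h * k
  sumAut-*ʳ h k = trans (sum-cong-≗ (λ a → sym (*-assoc (𝟙Aut (finToFun a)) (h (finToFun a)) k)))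
                        (sym (*-distribʳ-sum k (λ a → 𝟙Aut (finToFun a) * h (finToFun a))))

  sumAut-compose : ∀ α β → IsAutomorphism D α → IsAutomorphism D β → ∀ {h} → Extensional h →
                   sumAut (λ σ → h (to α ∘ σ ∘ to β)) ≡ sumAut h
  sumAut-compose α β α-aut β-aut {h} h-ext = begin
    sumAut (λ σ → h (to α ∘ σ ∘ to β))
      ≡⟨ sum-cong-≗ (λ a → cong (_* h (to α ∘ finToFun a ∘ to β)) (weight-compose (finToFun a))) ⟨
    sumMaps (λ σ → 𝟙Aut (to α ∘ σ ∘ to β) * h (to α ∘ σ ∘ to β))
      ≡⟨ sumMaps-compose α β (λ f≗g → cong₂ _*_ (𝟙Aut-resp f≗g) (h-ext f≗g)) ⟩
    sumAut h
      ∎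
    where
      open ≡-Reasoning
      weight-compose : ∀ σ → 𝟙Aut (to α ∘ σ ∘ to β) ≡ 𝟙Aut σ
      weight-compose σ = cong 𝟙 (does-⇔ (IsAutomorphismMap-compose⇔ α β α-aut β-aut)
                                  (isAutomorphismMap? (to α ∘ σ ∘ to β)) (isAutomorphismMap? σ))

  h≤sumAut : ∀ {h σ} → Extensional h → IsAutomorphismMap σ → h σ ≤ sumAut h
  h≤sumAut {h} {σ} h-ext σ-aut = begin
    h σ                     ≡⟨ h-ext (finToFun-funToFin σ) ⟨
    h σ′                    ≡⟨ +-identityʳ (h σ′) ⟨
    1 * h σ′                ≡⟨ cong (λ b → 𝟙 b * h σ′) (dec-true (isAutomorphismMap? σ′) σ′-aut) ⟨
    𝟙Aut σ′ * h σ′          ≤⟨ f≤sum (λ a → 𝟙Aut (finToFun a) * h (finToFun a)) (funToFin σ) ⟩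
    sumAut h                ∎
    where
      open ≤-Reasoning
      σ′ = finToFun (funToFin σ)
      σ′-aut = IsAutomorphismMap-resp (sym ∘ finToFun-funToFin σ) σ-aut

  sum-∘-automorphism : ∀ {σ} → IsAutomorphismMap σ → (h : V → ℕ) → sum (h ∘ σ) ≡ sum h
  sum-∘-automorphism σ-aut h = sym (sum-permute h (map⇒↔ σ-aut))

  #[_↦_] : V → V → ℕ
  #[ x ↦ z ] = sumAut (λ σ → 𝟙 (does (σ x ≟ z)))

  #[v↦v]-positive : ∀ v → 1 ≤ #[ v ↦ v ]
  #[v↦v]-positive v = ≤-trans (≤-reflexive (cong 𝟙 (sym (dec-true (v ≟ v) refl))))
                              (h≤sumAut (λ f≗g → cong (λ y → 𝟙 (does (y ≟ v))) (f≗g v)) id-aut)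
    where
      id-aut : IsAutomorphismMap (λ x → x)
      id-aut = (λ _ _ eq → eq) , (λ z → z , refl) , (λ _ _ → refl)

  -- With α v ≡ z and β v ≡ x, σ ↦ α ∘ σ ∘ β⁻¹ carries the automorphisms fixing v
  -- onto those sending x to z.
  #[↦]-constant : VertexTransitive D → ∀ v x z → #[ x ↦ z ] ≡ #[ v ↦ v ]
  #[↦]-constant vt v x z with vt v x | vt v z
  ... | β , β-aut , βv≡x | α , α-aut , αv≡z = begin
    #[ x ↦ z ]                                       ≡⟨ sumAut-compose α (↔-sym β) α-aut (automorphism-sym β β-aut) ext ⟨
    sumAut (λ σ → 𝟙 (does (to α (σ (from β x)) ≟ z))) ≡⟨ sumAut-cong (λ σ _ → cong (λ y → 𝟙 (does (to α (σ y) ≟ z))) β⁻¹x≡v) ⟩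
    sumAut (λ σ → 𝟙 (does (to α (σ v) ≟ z)))          ≡⟨ sumAut-cong (λ σ _ → cong 𝟙 (does-⇔ (α-hits-z (σ v)) (to α (σ v) ≟ z) (σ v ≟ v))) ⟩
    #[ v ↦ v ]                                       ∎
    where
      open ≡-Reasoning
      ext : Extensional (λ σ → 𝟙 (does (σ x ≟ z)))
      ext f≗g = cong (λ y → 𝟙 (does (y ≟ z))) (f≗g x)
      β⁻¹x≡v : from β x ≡ v
      β⁻¹x≡v = trans (cong (from β) (sym βv≡x)) (strictlyInverseʳ β v)
      α-hits-z : ∀ y → (to α y ≡ z) ⇔ (y ≡ v)
      α-hits-z y = mk⇔
        (λ αy≡z → trans (sym (strictlyInverseʳ α y))
                    (trans (cong (from α) (trans αy≡z (sym αv≡z))) (strictlyInverseʳ α v)))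
        (λ y≡v → trans (cong (to α) y≡v) αv≡z)

  sumAut-orbit : VertexTransitive D → ∀ v x (h : V → ℕ) → sumAut (λ σ → h (σ x)) ≡ #[ v ↦ v ] * sum h
  sumAut-orbit vt v x h = begin
    sumAut (λ σ → h (σ x))                                 ≡⟨ sumAut-cong (λ σ _ → sum-δ h (σ x)) ⟩
    sumAut (λ σ → sum (λ z → 𝟙 (does (σ x ≟ z)) * h z))   ≡⟨ sumAut-comm (λ σ z → 𝟙 (does (σ x ≟ z)) * h z) ⟩
    sum (λ z → sumAut (λ σ → 𝟙 (does (σ x ≟ z)) * h z))   ≡⟨ sum-cong-≗ (λ z → sumAut-*ʳ (λ σ → 𝟙 (does (σ x ≟ z))) (h z)) ⟩
    sum (λ z → #[ x ↦ z ] * h z)                           ≡⟨ sum-cong-≗ (λ z → cong (_* h z) (#[↦]-constant vt v x z)) ⟩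
    sum (λ z → #[ v ↦ v ] * h z)                           ≡⟨ *-distribˡ-sum #[ v ↦ v ] h ⟨
    #[ v ↦ v ] * sum h                                     ∎
    where open ≡-Reasoning

  heads : ∀ {u v k} → Walk D u v k → Fin k → V
  heads (cons {w = w} _ _) zero    = w
  heads (cons _ p)         (suc i) = heads p i

  walk-map : ∀ {σ} → ArcPreserving σ → ∀ {u v k} → Walk D u v k → Walk D (σ u) (σ v) k
  walk-map σ-pres nil                = nil
  walk-map σ-pres (cons {u} {w} e p) = cons (trans (σ-pres u w) e) (walk-map σ-pres p)

  heads-walk-map : ∀ {σ} (σ-pres : ArcPreserving σ) {u v k} (p : Walk D u v k) i →
                   heads (walk-map σ-pres p) i ≡ σ (heads p i)
  heads-walk-map σ-pres (cons e p) zero    = refl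
  heads-walk-map σ-pres (cons e p) (suc i) = heads-walk-map σ-pres p i

  N⁺-intro : ∀ U {v w} → lookup U v ≡ true → A v w ≡ true → lookup U w ≡ false → lookup (N⁺ D U) w ≡ true
  N⁺-intro U {v} {w} v∈U vw w∉U = begin
    lookup (N⁺ D U) w                                    ≡⟨ lookup∘tabulate _ w ⟩
    not (lookup U w) ∧ anyFin (λ x → lookup U x ∧ A x w) ≡⟨ cong₂ _∧_ (cong not w∉U) (anyFin-intro _ v (cong₂ _∧_ v∈U vw)) ⟩
    true                                                 ∎
    where open ≡-Reasoning

  walk-leaves : ∀ U {u v k} (p : Walk D u v k) → lookup U u ≡ true → lookup U v ≡ false →
                ∃[ i ] lookup (N⁺ D U) (heads p i) ≡ true
  walk-leaves U nil u∈U u∉U = contradiction (trans (sym u∈U) u∉U) λ ()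
  walk-leaves U (cons {w = w} e p) u∈U v∉U with lookup U w in w∈U?
  ... | true  = let i , head∈N⁺ = walk-leaves U p w∈U? v∉U in suc i , head∈N⁺
  ... | false = zero , N⁺-intro U u∈U e w∈U?

  leaving≤heads-in-N⁺ : ∀ U {u v k} (p : Walk D u v k) →
                        𝟙 (lookup U u) * 𝟙 (not (lookup U v)) ≤ sum (λ i → 𝟙 (lookup (N⁺ D U) (heads p i)))
  leaving≤heads-in-N⁺ U {u} {v} p with lookup U u in u∈U? | lookup U v in v∈U?
  ... | false | _     = z≤n
  ... | true  | true  = z≤n
  ... | true  | false = let i , head∈N⁺ = walk-leaves U p u∈U? v∈U? in
    ≤-trans (≤-reflexive (cong 𝟙 (sym head∈N⁺))) (f≤sum (λ i → 𝟙 (lookup (N⁺ D U) (heads p i))) i)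

  image-leaving≤heads-in-N⁺ : ∀ U {σ} → ArcPreserving σ → ∀ {u v k} (p : Walk D u v k) →
                              𝟙 (lookup U (σ u)) * 𝟙 (not (lookup U (σ v))) ≤ sum (λ i → 𝟙 (lookup (N⁺ D U) (σ (heads p i))))
  image-leaving≤heads-in-N⁺ U σ-pres p =
    ≤-trans (leaving≤heads-in-N⁺ U (walk-map σ-pres p))
            (≤-reflexive (sum-cong-≗ (λ i → cong (λ x → 𝟙 (lookup (N⁺ D U) x)) (heads-walk-map σ-pres p i))))

  ReachesAllWithin : V → ℕ → Set
  ReachesAllWithin v₀ d = ∀ y → ∃[ k ] (k ≤ d × Walk D v₀ y k)

  crossings : V → Subset (n D) → ℕ
  crossings v₀ U = sumAut (λ σ → sum (λ y → 𝟙 (lookup U (σ v₀)) * 𝟙 (not (lookup U (σ y)))))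

  crossings≡ : VertexTransitive D → ∀ v₀ U → crossings v₀ U ≡ #[ v₀ ↦ v₀ ] * (∣ U ∣ * ∣ ∁ U ∣)
  crossings≡ vt v₀ U = begin
    crossings v₀ U                          ≡⟨ sumAut-cong row≡ ⟩
    sumAut (λ σ → ∈U (σ v₀) * ∣ ∁ U ∣)      ≡⟨ sumAut-*ʳ (λ σ → ∈U (σ v₀)) ∣ ∁ U ∣ ⟩
    sumAut (λ σ → ∈U (σ v₀)) * ∣ ∁ U ∣      ≡⟨ cong (_* ∣ ∁ U ∣) (sumAut-orbit vt v₀ v₀ ∈U) ⟩
    #[ v₀ ↦ v₀ ] * sum ∈U * ∣ ∁ U ∣          ≡⟨ cong (λ k → #[ v₀ ↦ v₀ ] * k * ∣ ∁ U ∣) (∣p∣≡sum𝟙 U) ⟨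
    #[ v₀ ↦ v₀ ] * ∣ U ∣ * ∣ ∁ U ∣           ≡⟨ *-assoc #[ v₀ ↦ v₀ ] ∣ U ∣ ∣ ∁ U ∣ ⟩
    #[ v₀ ↦ v₀ ] * (∣ U ∣ * ∣ ∁ U ∣)         ∎
    where
      open ≡-Reasoning
      ∈U ∉U : V → ℕ
      ∈U x = 𝟙 (lookup U x)
      ∉U x = 𝟙 (not (lookup U x))
      ∣∁U∣≡sum∉U : ∣ ∁ U ∣ ≡ sum ∉U
      ∣∁U∣≡sum∉U = trans (∣p∣≡sum𝟙 (∁ U)) (sum-cong-≗ (λ y → cong 𝟙 (lookup-map y not U)))
      row≡ : ∀ σ → IsAutomorphismMap σ → sum (λ y → ∈U (σ v₀) * ∉U (σ y)) ≡ ∈U (σ v₀) * ∣ ∁ U ∣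
      row≡ σ σ-aut = begin
        sum (λ y → ∈U (σ v₀) * ∉U (σ y))    ≡⟨ *-distribˡ-sum (∈U (σ v₀)) (∉U ∘ σ) ⟨
        ∈U (σ v₀) * sum (∉U ∘ σ)           ≡⟨ cong (∈U (σ v₀) *_) (sum-∘-automorphism σ-aut ∉U) ⟩
        ∈U (σ v₀) * sum ∉U                 ≡⟨ cong (∈U (σ v₀) *_) ∣∁U∣≡sum∉U ⟨
        ∈U (σ v₀) * ∣ ∁ U ∣                ∎

  crossings≤ : VertexTransitive D → ∀ v₀ d → ReachesAllWithin v₀ d → ∀ U →
               crossings v₀ U ≤ #[ v₀ ↦ v₀ ] * (n D * (d * ∣ N⁺ D U ∣))
  crossings≤ vt v₀ d reach U = begin
    crossings v₀ U                                          ≤⟨ sumAut-mono-≤ (λ σ (_ , _ , σ-pres) →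
                                                                 sum-mono-≤ (λ y → image-leaving≤heads-in-N⁺ U σ-pres (walk y))) ⟩
    sumAut (λ σ → sum (λ y → sum (λ i → ∈N (σ (heads (walk y) i)))))
                                                            ≡⟨ sumAut-comm (λ σ y → sum (λ i → ∈N (σ (heads (walk y) i)))) ⟩
    sum (λ y → sumAut (λ σ → sum (λ i → ∈N (σ (heads (walk y) i)))))
                                                            ≡⟨ sum-cong-≗ (λ y → sumAut-comm (λ σ i → ∈N (σ (heads (walk y) i)))) ⟩
    sum (λ y → sum (λ i → sumAut (λ σ → ∈N (σ (heads (walk y) i)))))
                                                            ≡⟨ sum-cong-≗ (λ y → sum-cong-≗ {len y} (λ i → sumAut-orbit vt v₀ (heads (walk y) i) ∈N)) ⟩
    sum (λ y → sum {len y} (λ _ → c * sum ∈N))               ≡⟨ sum-cong-≗ (λ y → sum-const (len y) (c * sum ∈N)) ⟩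
    sum (λ y → len y * (c * sum ∈N))                          ≤⟨ sum-mono-≤ (λ y → *-monoˡ-≤ (c * sum ∈N) (proj₁ (proj₂ (reach y)))) ⟩
    sum {n D} (λ _ → d * (c * sum ∈N))                       ≡⟨ sum-const (n D) (d * (c * sum ∈N)) ⟩
    n D * (d * (c * sum ∈N))                                 ≡⟨ cong (λ k → n D * (d * (c * k))) (∣p∣≡sum𝟙 (N⁺ D U)) ⟨
    n D * (d * (c * ∣ N⁺ D U ∣))                             ≡⟨ cong (n D *_) (x∙yz≈y∙xz d c ∣ N⁺ D U ∣) ⟩
    n D * (c * (d * ∣ N⁺ D U ∣))                             ≡⟨ x∙yz≈y∙xz (n D) c (d * ∣ N⁺ D U ∣) ⟩
    c * (n D * (d * ∣ N⁺ D U ∣))                             ∎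
    where
      open ≤-Reasoning
      c = #[ v₀ ↦ v₀ ]
      ∈N : V → ℕ
      ∈N x = 𝟙 (lookup (N⁺ D U) x)
      len : V → ℕ
      len y = proj₁ (reach y)
      walk : ∀ y → Walk D v₀ y (len y)
      walk y = proj₂ (proj₂ (reach y))

  ∣U∣*∣∁U∣≤n*[d*∣N⁺U∣] : VertexTransitive D → ∀ v₀ d → ReachesAllWithin v₀ d → ∀ U →
                          ∣ U ∣ * ∣ ∁ U ∣ ≤ n D * (d * ∣ N⁺ D U ∣)
  ∣U∣*∣∁U∣≤n*[d*∣N⁺U∣] vt v₀ d reach U =
    *-cancelˡ-≤ #[ v₀ ↦ v₀ ] {{>-nonZero (#[v↦v]-positive v₀)}}
      (≤-trans (≤-reflexive (sym (crossings≡ vt v₀ U))) (crossings≤ vt v₀ d reach U))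

  out-expansion : VertexTransitive D → ∀ v₀ d → ReachesAllWithin v₀ d →
                  ∀ U → 3 * ∣ U ∣ ≤ 2 * n D → ∣ U ∣ ≤ 3 * d * ∣ N⁺ D U ∣
  out-expansion vt v₀ d reach U 3∣U∣≤2n = subst (∣ U ∣ ≤_) (sym (*-assoc 3 d ∣ N⁺ D U ∣))
    (u*[m∸u]≤m*k⇒u≤3*k {{nonZeroIndex v₀}} 3∣U∣≤2n
      (subst (λ w → ∣ U ∣ * w ≤ n D * (d * ∣ N⁺ D U ∣)) (∣∁p∣≡n∸∣p∣ U) (∣U∣*∣∁U∣≤n*[d*∣N⁺U∣] vt v₀ d reach U)))

-- N⁺ (reverse D) U is definitionally N⁻ D U.
reverse : Digraph → Digraph
reverse D = record { n = n D ; arc = λ u v → arc D v u ; noLoop = noLoop D }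

walk-snoc : ∀ {D u v w k} → Walk D u v k → arc D v w ≡ true → Walk D u w (suc k)
walk-snoc nil        vw = cons vw nil
walk-snoc (cons e p) vw = cons e (walk-snoc p vw)

walk-reverse : ∀ {D u v k} → Walk D u v k → Walk (reverse D) v u k
walk-reverse nil        = nil
walk-reverse (cons e p) = walk-snoc (walk-reverse p) e

reverse-vertexTransitive : ∀ {D} → VertexTransitive D → VertexTransitive (reverse D)
reverse-vertexTransitive vt u v = let α , α-aut , αu≡v = vt u v in α , (λ x y → α-aut y x) , αu≡v

lemma2p2 : (D : Digraph) → 2 ≤ n D → Connected D → VertexTransitive D →
    (d : ℕ) → HasDirectedDiameter D d → IsExpander D 1 (3 * d)
lemma2p2 D 2≤n _ vt d (walks , _) = 2≤n , λ U 3∣U∣≤2n →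
    subst (_≤ 3 * d * ∣ N⁺ D U ∣) (sym (*-identityˡ ∣ U ∣))
      (out-expansion D vt v₀ d (walks v₀) U 3∣U∣≤2n) ,
    subst (_≤ 3 * d * ∣ N⁻ D U ∣) (sym (*-identityˡ ∣ U ∣))
      (out-expansion (reverse D) (reverse-vertexTransitive {D} vt) v₀ d
                     (λ y → let k , k≤d , p = walks y v₀ in k , k≤d , walk-reverse p) U 3∣U∣≤2n)
  where
    v₀ : Fin (n D)
    v₀ = fromℕ< 2≤n
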